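{- Let $T$ be a tree with no regular cores and exactly one core $v$, where $v$ is a small core with three standard legs. Let $L\subseteq V$ contain a local set of $v$. If $|L|\ge 3$, then $L$ is a landmark set of $T$. If $|L|\le 2$, then $L$ is a landmark set of $T$ if and only if $L$ consists of the two vertices of two short legs of $v$.
   Context: Let $T=(V,E)$ be a finite tree and $d(x,y)$ the number of edges on the path between $x$ and $y$. A vertex $\tau$ separates $u$ and $w$ if $d(u,\tau)\neq d(w,\tau)$. A set $L\subseteq V$ is a landmark set if every pair of distinct vertices $u,w\in V\setminus L$ is separated by at least two vertices of $L$. A core is a vertex of degree at least $3$. For a core $v$, the subtrees of the neighbors of $v$ are the connected components of $T-v$. A (standard) leg of $v$ is a subtree of a neighbor of $v$ containing no core (a path attached to $v$); it is short if it has one vertex and long otherwise. For a leg $\ell$ of $v$, $\ell^i$ denotes the vertex of $\ell$ at distance $i$ from $v$ (its position is $i$). A small core is a core of degree exactly $3$ with at least two legs, at least one of which is short; other cores are regular. Thus in this statement $T$ consists of $v$ and three paths (legs) attached to $v$, at least one of which is a single vertex. For a set $S$ and a standard leg $\ell$, $S\cap\ell$ is of type $(s,0)$ if empty; $(s,1)$ if it is a single vertex of position at least $2$; $(s,2)$ if it has at least two vertices; $(s,3)$ if it equals $\{\ell^1\}$. A local set of $v$ is a set $S$ of vertices of the legs of $v$ (so $v\notin S$) such that: (1) at most one leg has type $(s,0)$ and all other legs have type $(s,1)$, $(s,2)$ or $(s,3)$; (2) if some long leg $\ell$ has type $(s,0)$ then every long leg other than $\ell$ has type $(s,2)$; (3)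 if some short leg has type $(s,0)$ then every long leg has type $(s,2)$ or $(s,3)$. "$L$ contains a local set of $v$" means some subset of $L$ is a local set of $v$. -}

module Defs where

open import Data.Empty using (⊥)
open import Data.Nat using (ℕ; zero; suc; _+_; _≤_; _≥_; ∣_-_∣)
open import Data.Fin using (Fin; toℕ)
open import Data.Fin.Properties using () renaming (_≟_ to _≟F_)
open import Data.Product using (Σ; ∃; ∃-syntax; _×_; _,_)
open import Data.Sum using (_⊎_)
open import Data.List using (List; length)
open import Data.List.Membership.Propositional using (_∈_; _∉_)
open import Relation.Nullary using (¬_; yes; no)
open import Relation.Binary.PropositionalEquality using (_≡_; _≢_)

-- The tree T: a single core v ("center") with three standard legs,
-- indexed by Fin 3; leg i is a path with  len i ≥ 1  vertices.
-- The vertex  leg i p  (p : Fin (len i)) is ℓ_i^{toℕ p + 1}.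
data Vert (len : Fin 3 → ℕ) : Set where
  center : Vert len
  leg    : (i : Fin 3) → Fin (len i) → Vert len

pos : {n : ℕ} → Fin n → ℕ
pos p = suc (toℕ p)

dist : {len : Fin 3 → ℕ} → Vert len → Vert len → ℕ
dist center center = 0
dist center (leg i p) = pos p
dist (leg i p) center = pos p
dist (leg i p) (leg j q) with i ≟F j
... | yes _ = ∣ pos p - pos q ∣
... | no  _ = pos p + pos q

Separates : {len : Fin 3 → ℕ} → Vert len → Vert len → Vert len → Set
Separates τ u w = dist u τ ≢ dist w τ

IsLandmark : {len : Fin 3 → ℕ} → List (Vert len) → Set
IsLandmark {len} L = (u w : Vert len) → u ≢ w → u ∉ L → w ∉ L →
  ∃[ τ₁ ] ∃[ τ₂ ] (τ₁ ≢ τ₂ × τ₁ ∈ L × τ₂ ∈ L × Separates τ₁ u w × Separates τ₂ u w)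

Short Long : (len : Fin 3 → ℕ) → Fin 3 → Set
Short len i = len i ≡ 1
Long  len i = len i ≥ 2

Type0 Type1 Type2 Type3 : {len : Fin 3 → ℕ} → (Vert len → Set) → Fin 3 → Set
Type0 {len} S i = (p : Fin (len i)) → ¬ S (leg i p)
Type1 {len} S i = ∃[ p ] (pos p ≥ 2 × S (leg i p) ×
                    ((q : Fin (len i)) → S (leg i q) → q ≡ p))
Type2 {len} S i = ∃[ p ] ∃[ q ] (p ≢ q × S (leg i p) × S (leg i q))
Type3 {len} S i = ∃[ p ] (pos p ≡ 1 × S (leg i p) ×
                    ((q : Fin (len i)) → S (leg i q) → q ≡ p))

IsLocalSet : {len : Fin 3 → ℕ} → (Vert len → Set) → Set
IsLocalSet {len} S =
  ¬ S center ×
  ((i j : Fin 3) → i ≢ j → Type0 S i → Type0 S j → ⊥) ×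
  ((i : Fin 3) → Type0 S i ⊎ Type1 S i ⊎ Type2 S i ⊎ Type3 S i) ×
  ((i : Fin 3) → Long len i → Type0 S i →
     (j : Fin 3) → j ≢ i → Long len j → Type2 S j) ×
  ((i : Fin 3) → Short len i → Type0 S i →
     (j : Fin 3) → Long len j → Type2 S j ⊎ Type3 S j)

ContainsLocalSet : {len : Fin 3 → ℕ} → List (Vert len) → Set₁
ContainsLocalSet {len} L =
  Σ (Vert len → Set) λ S → ((x : Vert len) → S x → x ∈ L) × IsLocalSet S

IsFirstOf : {len : Fin 3 → ℕ} → Vert len → Fin 3 → Set
IsFirstOf center i = ⊥
IsFirstOf (leg j p) i = j ≡ i × pos p ≡ 1

module Submission where

-- Give every vertex x a signed coordinate along the line through
-- leg i: +pos on leg i, -pos on the other legs, 0 at v.  The distance from x to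
-- a vertex of leg i at position t is |coord i x - t|, so if two distinct vertices
-- u, w are equidistant from two distinct vertices τ ≠ τ', comparing coordinates
-- forces u, w to be "twins": vertices at the same position on two different legs.
-- Twins are separated by every vertex of their two legs, and the local-set
-- conditions guarantee two such vertices in S ⊆ L.  Hence, for |L| ≥ 3, among
-- three vertices of L either two separate u, w, or two do not and u, w are
-- twins, which S separates.  For |L| ≤ 2, L consists of one S-vertex on each of
-- two legs beside an empty leg; if one of these legs were long, the local-set
-- rules make it contain ℓ^1 only, and then v and ℓ^2 are separated by at most
-- one vertex of L.  Conversely, the first vertices of two short legs separate
-- any two vertices of the remaining path v, ℓ^1, ℓ^2, ... by their heights.

open import Defs
open import Data.Empty using (⊥; ⊥-elim)
open import Data.Nat as ℕ using (ℕ; zero; suc; _≤_; _≥_; z≤n; s≤s)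
import Data.Nat.Properties as ℕP
open import Data.Fin using (Fin; toℕ; zero; suc; fromℕ<)
open import Data.Fin.Properties using (toℕ-injective; toℕ-fromℕ<) renaming (_≟_ to _≟F_)
open import Data.Integer as ℤ using (ℤ; +_; 0ℤ)
import Data.Integer.Properties as ℤP
open import Data.Integer.Tactic.RingSolver using (solve-∀)
open import Data.Product using (∃-syntax; _×_; _,_; proj₁; proj₂)
open import Data.Sum using (_⊎_; inj₁; inj₂)
open import Data.List using (List; []; _∷_; length)
open import Data.List.Membership.Propositional using (_∈_; _∉_)
open import Data.List.Relation.Unary.Any using (here; there)
open import Data.List.Relation.Unary.All using (_∷_)
open import Data.List.Relation.Unary.AllPairs using (_∷_)
open import Data.List.Relation.Unary.Unique.Propositional using (Unique)
open import Relation.Nullary using (¬_; yes; no)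
open import Relation.Unary using (Decidable)
open import Relation.Binary.PropositionalEquality

DistinctPair : {A : Set} → (A → Set) → (A → Set) → Set
DistinctPair P Q = ∃[ x ] ∃[ y ] (x ≢ y × P x × P y × Q x × Q y)

DistinctPair-map : {A : Set} {P P′ Q Q′ : A → Set} →
  (∀ {x} → P x → P′ x) → (∀ {x} → Q x → Q′ x) → DistinctPair P Q → DistinctPair P′ Q′
DistinctPair-map f g (x , y , x≢y , px , py , qx , qy) = x , y , x≢y , f px , f py , g qx , g qy

no-distinct-pair : {A : Set} {L : List A} {Q : A → Set} {x y : A} →
  (∀ {z} → z ∈ L → z ≡ x ⊎ z ≡ y) → ¬ Q x → ¬ DistinctPair (_∈ L) Q
no-distinct-pair members ¬qx (τ₁ , τ₂ , τ₁≢τ₂ , τ₁∈ , τ₂∈ , q₁ , q₂)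
  with members τ₁∈ | members τ₂∈
... | inj₁ refl | _         = ¬qx q₁
... | inj₂ _    | inj₁ refl = ¬qx q₂
... | inj₂ refl | inj₂ refl = τ₁≢τ₂ refl

module _ {A : Set} where

  three-members : {xs : List A} → Unique xs → 3 ≤ length xs →
    ∃[ a ] ∃[ b ] ∃[ c ] (a ≢ b × a ≢ c × b ≢ c × a ∈ xs × b ∈ xs × c ∈ xs)
  three-members {a ∷ b ∷ c ∷ _} ((a≢b ∷ a≢c ∷ _) ∷ (b≢c ∷ _) ∷ _) _ =
    a , b , c , a≢b , a≢c , b≢c , here refl , there (here refl) , there (there (here refl))
  three-members {_ ∷ []} _ (s≤s ())
  three-members {_ ∷ _ ∷ []} _ (s≤s (s≤s ()))

  pair-members : {xs : List A} {x y z : A} → length xs ≤ 2 → x ≢ y →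
    x ∈ xs → y ∈ xs → z ∈ xs → z ≡ x ⊎ z ≡ y
  pair-members {_ ∷ []} _ x≢y (here refl) (here refl) _ = ⊥-elim (x≢y refl)
  pair-members {_ ∷ _ ∷ []} _ x≢y (here refl) (here refl) _ = ⊥-elim (x≢y refl)
  pair-members {_ ∷ _ ∷ []} _ _ (here refl) (there (here refl)) (here refl) = inj₁ refl
  pair-members {_ ∷ _ ∷ []} _ _ (here refl) (there (here refl)) (there (here refl)) = inj₂ refl
  pair-members {_ ∷ _ ∷ []} _ _ (there (here refl)) (here refl) (here refl) = inj₂ refl
  pair-members {_ ∷ _ ∷ []} _ _ (there (here refl)) (here refl) (there (here refl)) = inj₁ refl
  pair-members {_ ∷ _ ∷ []} _ x≢y (there (here refl)) (there (here refl)) _ = ⊥-elim (x≢y refl)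
  pair-members {_ ∷ _ ∷ _ ∷ _} (s≤s (s≤s ())) _ _ _ _

  no-three-members : {xs : List A} {x y z : A} → length xs ≤ 2 →
    x ≢ y → x ≢ z → y ≢ z → x ∈ xs → y ∈ xs → z ∈ xs → ⊥
  no-three-members l≤2 x≢y x≢z y≢z x∈ y∈ z∈ with pair-members l≤2 x≢y x∈ y∈ z∈
  ... | inj₁ refl = x≢z refl
  ... | inj₂ refl = y≢z refl

  two-of-three : {P Q : A → Set} → Decidable P → {x y z : A} →
    x ≢ y → x ≢ z → y ≢ z → Q x → Q y → Q z →
    DistinctPair Q P ⊎ DistinctPair Q (λ a → ¬ P a)
  two-of-three P? {x} {y} {z} x≢y x≢z y≢z qx qy qz with P? x | P? y | P? z
  ... | yes px  | yes py  | _       = inj₁ (x , y , x≢y , qx , qy , px , py)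
  ... | yes px  | no _    | yes pz  = inj₁ (x , z , x≢z , qx , qz , px , pz)
  ... | no _    | yes py  | yes pz  = inj₁ (y , z , y≢z , qy , qz , py , pz)
  ... | no ¬px  | no ¬py  | _       = inj₂ (x , y , x≢y , qx , qy , ¬px , ¬py)
  ... | no ¬px  | yes _   | no ¬pz  = inj₂ (x , z , x≢z , qx , qz , ¬px , ¬pz)
  ... | yes _   | no ¬py  | no ¬pz  = inj₂ (y , z , y≢z , qy , qz , ¬py , ¬pz)

avoid-1-2 : (m : Fin 3) → m ≢ suc zero → m ≢ suc (suc zero) → m ≡ zero
avoid-1-2 zero _ _ = refl
avoid-1-2 (suc zero) m≢1 _ = ⊥-elim (m≢1 refl)
avoid-1-2 (suc (suc zero)) _ m≢2 = ⊥-elim (m≢2 refl)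

avoid-0-2 : (m : Fin 3) → m ≢ zero → m ≢ suc (suc zero) → m ≡ suc zero
avoid-0-2 zero m≢0 _ = ⊥-elim (m≢0 refl)
avoid-0-2 (suc zero) _ _ = refl
avoid-0-2 (suc (suc zero)) _ m≢2 = ⊥-elim (m≢2 refl)

avoid-0-1 : (m : Fin 3) → m ≢ zero → m ≢ suc zero → m ≡ suc (suc zero)
avoid-0-1 zero m≢0 _ = ⊥-elim (m≢0 refl)
avoid-0-1 (suc zero) _ m≢1 = ⊥-elim (m≢1 refl)
avoid-0-1 (suc (suc zero)) _ _ = refl

third-leg : (i j : Fin 3) → i ≢ j →
  ∃[ k ] (k ≢ i × k ≢ j × ((m : Fin 3) → m ≢ i → m ≢ j → m ≡ k))
third-leg zero zero i≢j = ⊥-elim (i≢j refl)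
third-leg zero (suc zero) _ = suc (suc zero) , (λ ()) , (λ ()) , avoid-0-1
third-leg zero (suc (suc zero)) _ = suc zero , (λ ()) , (λ ()) , avoid-0-2
third-leg (suc zero) zero _ = suc (suc zero) , (λ ()) , (λ ()) , λ m m≢1 m≢0 → avoid-0-1 m m≢0 m≢1
third-leg (suc zero) (suc zero) i≢j = ⊥-elim (i≢j refl)
third-leg (suc zero) (suc (suc zero)) _ = zero , (λ ()) , (λ ()) , avoid-1-2
third-leg (suc (suc zero)) zero _ = suc zero , (λ ()) , (λ ()) , λ m m≢2 m≢0 → avoid-0-2 m m≢0 m≢2
third-leg (suc (suc zero)) (suc zero) _ = zero , (λ ()) , (λ ()) , λ m m≢2 m≢1 → avoid-1-2 m m≢1 m≢2
third-leg (suc (suc zero)) (suc (suc zero)) i≢j = ⊥-elim (i≢j refl)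

other-legs : (k : Fin 3) → ∃[ i ] ∃[ j ] (i ≢ j × i ≢ k × j ≢ k)
other-legs zero = suc zero , suc (suc zero) , (λ ()) , (λ ()) , (λ ())
other-legs (suc zero) = zero , suc (suc zero) , (λ ()) , (λ ()) , (λ ())
other-legs (suc (suc zero)) = zero , suc zero , (λ ()) , (λ ()) , (λ ())

short-or-long : {n : ℕ} → n ≥ 1 → n ≡ 1 ⊎ n ≥ 2
short-or-long {suc zero} _ = inj₁ refl
short-or-long {suc (suc _)} _ = inj₂ (s≤s (s≤s z≤n))

single-vertex : {n : ℕ} → n ≡ 1 → Fin n
single-vertex refl = zero

single-vertex-unique : {n : ℕ} → n ≡ 1 → (a b : Fin n) → a ≡ b
single-vertex-unique refl zero zero = refl

single-position : {n : ℕ} → n ≡ 1 → (a : Fin n) → pos a ≡ 1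
single-position refl zero = refl

pos-injective : {n : ℕ} {a b : Fin n} → pos a ≡ pos b → a ≡ b
pos-injective e = toℕ-injective (ℕP.suc-injective e)

∣m⊖n∣≡∣m-n∣ : ∀ m n → ℤ.∣ m ℤ.⊖ n ∣ ≡ ℕ.∣ m - n ∣
∣m⊖n∣≡∣m-n∣ zero zero = refl
∣m⊖n∣≡∣m-n∣ zero (suc n) = refl
∣m⊖n∣≡∣m-n∣ (suc m) zero = refl
∣m⊖n∣≡∣m-n∣ (suc m) (suc n) =
  trans (cong ℤ.∣_∣ (ℤP.[1+m]⊖[1+n]≡m⊖n m n)) (∣m⊖n∣≡∣m-n∣ m n)

abs-equal : ∀ a b → ℤ.∣ a ∣ ≡ ℤ.∣ b ∣ → a ≡ b ⊎ a ≡ ℤ.- b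
abs-equal a b e with ℤP.+∣i∣≡i⊎+∣i∣≡-i a | ℤP.+∣i∣≡i⊎+∣i∣≡-i b
... | inj₁ ea | inj₁ eb = inj₁ (trans (sym ea) (trans (cong +_ e) eb))
... | inj₁ ea | inj₂ eb = inj₂ (trans (sym ea) (trans (cong +_ e) eb))
... | inj₂ ea | inj₁ eb = inj₂ (trans (sym (ℤP.neg-involutive a))
                                  (cong ℤ.-_ (trans (sym ea) (trans (cong +_ e) eb))))
... | inj₂ ea | inj₂ eb = inj₁ (ℤP.neg-injective (trans (sym ea) (trans (cong +_ e) eb)))

equidistant-on-line : ∀ x y z → ℤ.∣ x ℤ.- z ∣ ≡ ℤ.∣ y ℤ.- z ∣ → x ≡ y ⊎ x ℤ.+ y ≡ z ℤ.+ z
equidistant-on-line x y z e with abs-equal (x ℤ.- z) (y ℤ.- z) e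
... | inj₁ same = inj₁ (begin
  x               ≡⟨ shift x z ⟩
  (x ℤ.- z) ℤ.+ z ≡⟨ cong (ℤ._+ z) same ⟩
  (y ℤ.- z) ℤ.+ z ≡⟨ sym (shift y z) ⟩
  y               ∎)
  where
    open ≡-Reasoning
    shift : ∀ a b → a ≡ (a ℤ.- b) ℤ.+ b
    shift = solve-∀
... | inj₂ opposite = inj₂ (begin
  x ℤ.+ y                                           ≡⟨ regroup x y z ⟩
  (x ℤ.- z) ℤ.+ (y ℤ.- z) ℤ.+ (z ℤ.+ z)             ≡⟨ cong (λ a → a ℤ.+ (y ℤ.- z) ℤ.+ (z ℤ.+ z)) opposite ⟩
  ℤ.- (y ℤ.- z) ℤ.+ (y ℤ.- z) ℤ.+ (z ℤ.+ z)         ≡⟨ cancel (y ℤ.- z) (z ℤ.+ z) ⟩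
  z ℤ.+ z                                           ∎)
  where
    open ≡-Reasoning
    regroup : ∀ a b c → a ℤ.+ b ≡ (a ℤ.- c) ℤ.+ (b ℤ.- c) ℤ.+ (c ℤ.+ c)
    regroup = solve-∀
    cancel : ∀ a b → ℤ.- a ℤ.+ a ℤ.+ b ≡ b
    cancel = solve-∀

double-injective : ∀ m n → m ℕ.+ m ≡ n ℕ.+ n → m ≡ n
double-injective zero zero _ = refl
double-injective (suc m) (suc n) e = cong suc (double-injective m n (ℕP.suc-injective
  (trans (sym (ℕP.+-suc m m)) (trans (ℕP.suc-injective e) (ℕP.+-suc n n)))))

∣m-n∣≢m+n : ∀ m n → ℕ.∣ suc m - suc n ∣ ≢ suc m ℕ.+ suc n
∣m-n∣≢m+n m n = ℕP.<⇒≢ (begin-strict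
  ℕ.∣ m - n ∣        ≤⟨ ℕP.∣m-n∣≤m⊔n m n ⟩
  m ℕ.⊔ n            ≤⟨ ℕP.m⊔n≤m+n m n ⟩
  m ℕ.+ n            <⟨ ℕP.+-mono-< (ℕP.n<1+n m) (ℕP.n<1+n n) ⟩
  suc m ℕ.+ suc n    ∎)
  where open ℕP.≤-Reasoning

module _ {len : Fin 3 → ℕ} where

  V : Set
  V = Vert len

  leg-injective : ∀ {j} {a b : Fin (len j)} → leg {len} j a ≡ leg j b → a ≡ b
  leg-injective refl = refl

  leg-index : ∀ {j k} {a : Fin (len j)} {b : Fin (len k)} → leg {len} j a ≡ leg k b → j ≡ k
  leg-index refl = refl

  dist-same-leg : (j : Fin 3) (p r : Fin (len j)) →
    dist (leg {len} j p) (leg j r) ≡ ℕ.∣ pos p - pos r ∣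
  dist-same-leg j p r with j ≟F j
  ... | yes _ = refl
  ... | no j≢j = ⊥-elim (j≢j refl)

  dist-other-leg : {j k : Fin 3} → j ≢ k → (p : Fin (len j)) (r : Fin (len k)) →
    dist (leg {len} j p) (leg k r) ≡ pos p ℕ.+ pos r
  dist-other-leg {j} {k} j≢k p r with j ≟F k
  ... | yes j≡k = ⊥-elim (j≢k j≡k)
  ... | no _ = refl

  coord : Fin 3 → V → ℤ
  coord i center = 0ℤ
  coord i (leg j p) with j ≟F i
  ... | yes _ = + pos p
  ... | no _ = ℤ.- (+ pos p)

  dist-coord : (x : V) (i : Fin 3) (t : Fin (len i)) →
    dist x (leg i t) ≡ ℤ.∣ coord i x ℤ.- + pos t ∣
  dist-coord center i t = refl
  dist-coord (leg j p) i t with j ≟F i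
  ... | yes _ = sym (trans (cong ℤ.∣_∣ (ℤP.[+m]-[+n]≡m⊖n (pos p) (pos t))) (∣m⊖n∣≡∣m-n∣ (pos p) (pos t)))
  ... | no _ = cong suc (ℕP.+-suc (toℕ p) (toℕ t))

  data Twins : V → V → Set where
    twins : ∀ {j k} (p : Fin (len j)) (q : Fin (len k)) → j ≢ k → pos p ≡ pos q →
      Twins (leg j p) (leg k q)

  coord-collision : (i : Fin 3) (u w : V) → coord i u ≡ coord i w → u ≡ w ⊎ Twins u w
  coord-collision i center center _ = inj₁ refl
  coord-collision i center (leg k q) e with k ≟F i
  coord-collision i center (leg k q) () | yes _
  coord-collision i center (leg k q) () | no _
  coord-collision i (leg j p) center e with j ≟F i
  coord-collision i (leg j p) center () | yes _
  coord-collision i (leg j p) center () | no _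
  coord-collision i (leg j p) (leg k q) e with j ≟F i | k ≟F i
  ... | yes refl | yes refl = inj₁ (cong (leg j) (pos-injective (ℤP.+-injective e)))
  ... | no _ | no _ with j ≟F k
  ...   | yes refl = inj₁ (cong (leg j) (toℕ-injective (ℤP.-[1+-injective e)))
  ...   | no j≢k = inj₂ (twins p q j≢k (cong suc (ℤP.-[1+-injective e)))
  coord-collision i (leg j p) (leg k q) () | yes _ | no _
  coord-collision i (leg j p) (leg k q) () | no _ | yes _

  center-collision : (u w : V) → dist u center ≡ dist w center → u ≡ w ⊎ Twins u w
  center-collision center center _ = inj₁ refl
  center-collision center (leg k q) ()
  center-collision (leg j p) center ()
  center-collision (leg j p) (leg k q) e with j ≟F k
  ... | yes refl = inj₁ (cong (leg j) (pos-injective e))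
  ... | no j≢k = inj₂ (twins p q j≢k e)

  coord-sum-nonpositive : {i i′ : Fin 3} → i ≢ i′ → (x : V) → coord i x ℤ.+ coord i′ x ℤ.≤ 0ℤ
  coord-sum-nonpositive i≢i′ center = ℤP.≤-refl
  coord-sum-nonpositive {i} {i′} i≢i′ (leg j p) with j ≟F i | j ≟F i′
  ... | yes refl | yes refl = ⊥-elim (i≢i′ refl)
  ... | yes _ | no _ = ℤP.≤-reflexive (ℤP.+-inverseʳ (+ pos p))
  ... | no _ | yes _ = ℤP.≤-reflexive (ℤP.+-inverseˡ (+ pos p))
  ... | no _ | no _ = ℤ.-≤+

  leg-collision : (i : Fin 3) (t : Fin (len i)) (u w : V) → dist u (leg i t) ≡ dist w (leg i t) →
    u ≡ w ⊎ Twins u w ⊎ coord i u ℤ.+ coord i w ≡ + (pos t ℕ.+ pos t)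
  leg-collision i t u w e
    with equidistant-on-line (coord i u) (coord i w) (+ pos t)
           (trans (sym (dist-coord u i t)) (trans e (dist-coord w i t)))
  ... | inj₂ mirrored = inj₂ (inj₂ mirrored)
  ... | inj₁ same with coord-collision i u w same
  ...   | inj₁ u≡w = inj₁ u≡w
  ...   | inj₂ twin = inj₂ (inj₁ twin)

  -- Mirroring through vertices on two different legs is impossible, since
  -- the sum of the four coordinates would be both positive and non-positive.
  mirrored-twice : {i i′ : Fin 3} → i ≢ i′ → (u w : V) (m n : ℕ) →
    coord i u ℤ.+ coord i w ≡ + (suc m ℕ.+ suc m) →
    coord i′ u ℤ.+ coord i′ w ≡ + (suc n ℕ.+ suc n) → ⊥
  mirrored-twice {i} {i′} i≢i′ u w m n mirror mirror′ with
    subst (ℤ._≤ 0ℤ) sum (ℤP.+-mono-≤ (coord-sum-nonpositive i≢i′ u) (coord-sum-nonpositive i≢i′ w))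
    where
      regroup : ∀ a b c d → (a ℤ.+ b) ℤ.+ (c ℤ.+ d) ≡ (a ℤ.+ c) ℤ.+ (b ℤ.+ d)
      regroup = solve-∀
      sum : (coord i u ℤ.+ coord i′ u) ℤ.+ (coord i w ℤ.+ coord i′ w) ≡
            + (suc m ℕ.+ suc m ℕ.+ (suc n ℕ.+ suc n))
      sum = trans (regroup (coord i u) (coord i′ u) (coord i w) (coord i′ w)) (cong₂ ℤ._+_ mirror mirror′)
  ... | ℤ.+≤+ ()

  equidistant-twins : (u w τ τ′ : V) → u ≢ w → τ ≢ τ′ →
    dist u τ ≡ dist w τ → dist u τ′ ≡ dist w τ′ → Twins u w
  equidistant-twins u w center τ′ u≢w _ e _ with center-collision u w e
  ... | inj₁ u≡w = ⊥-elim (u≢w u≡w)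
  ... | inj₂ twin = twin
  equidistant-twins u w (leg i t) center u≢w _ _ e′ with center-collision u w e′
  ... | inj₁ u≡w = ⊥-elim (u≢w u≡w)
  ... | inj₂ twin = twin
  equidistant-twins u w (leg i t) (leg i′ t′) u≢w τ≢τ′ e e′
    with leg-collision i t u w e | leg-collision i′ t′ u w e′
  ... | inj₁ u≡w | _ = ⊥-elim (u≢w u≡w)
  ... | inj₂ (inj₁ twin) | _ = twin
  ... | _ | inj₁ u≡w = ⊥-elim (u≢w u≡w)
  ... | _ | inj₂ (inj₁ twin) = twin
  ... | inj₂ (inj₂ mirror) | inj₂ (inj₂ mirror′) with i ≟F i′
  ...   | yes refl = ⊥-elim (τ≢τ′ (cong (leg i) (pos-injective
          (double-injective (pos t) (pos t′) (ℤP.+-injective (trans (sym mirror) mirror′))))))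
  ...   | no i≢i′ = ⊥-elim (mirrored-twice i≢i′ u w (toℕ t) (toℕ t′) mirror mirror′)

  data OnLeg (j : Fin 3) : V → Set where
    on-leg : (r : Fin (len j)) → OnLeg j (leg j r)

  twins-separated : {j k : Fin 3} {p : Fin (len j)} {q : Fin (len k)} → j ≢ k → pos p ≡ pos q →
    {τ : V} → OnLeg j τ ⊎ OnLeg k τ → Separates τ (leg j p) (leg k q)
  twins-separated {j} {k} {p} {q} j≢k same (inj₁ (on-leg r)) e =
    ∣m-n∣≢m+n (toℕ p) (toℕ r) (begin
      ℕ.∣ pos p - pos r ∣   ≡⟨ sym (dist-same-leg j p r) ⟩
      dist (leg j p) (leg j r) ≡⟨ e ⟩
      dist (leg k q) (leg j r) ≡⟨ dist-other-leg (≢-sym j≢k) q r ⟩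
      pos q ℕ.+ pos r        ≡⟨ cong (ℕ._+ pos r) (sym same) ⟩
      pos p ℕ.+ pos r        ∎)
    where open ≡-Reasoning
  twins-separated {j} {k} {p} {q} j≢k same (inj₂ (on-leg r)) e =
    ∣m-n∣≢m+n (toℕ q) (toℕ r) (begin
      ℕ.∣ pos q - pos r ∣   ≡⟨ sym (dist-same-leg k q r) ⟩
      dist (leg k q) (leg k r) ≡⟨ sym e ⟩
      dist (leg j p) (leg k r) ≡⟨ dist-other-leg j≢k p r ⟩
      pos p ℕ.+ pos r        ≡⟨ cong (ℕ._+ pos r) same ⟩
      pos q ℕ.+ pos r        ∎)
    where open ≡-Reasoning

  data OnSpine (k : Fin 3) : V → Set where
    at-center : OnSpine k center
    on-spine : (p : Fin (len k)) → OnSpine k (leg k p)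

  spine-height-injective : {k : Fin 3} {u w : V} → OnSpine k u → OnSpine k w →
    dist u center ≡ dist w center → u ≡ w
  spine-height-injective at-center at-center _ = refl
  spine-height-injective (on-spine p) (on-spine q) e = cong (leg _) (pos-injective e)

  dist-from-short-leg : {i k : Fin 3} → Short len i → i ≢ k → (t : Fin (len i)) →
    {x : V} → OnSpine k x → dist x (leg i t) ≡ suc (dist x center)
  dist-from-short-leg short-i _ t at-center = single-position short-i t
  dist-from-short-leg {i} {k} short-i i≢k t (on-spine p) = begin
    dist (leg k p) (leg i t)  ≡⟨ dist-other-leg (≢-sym i≢k) p t ⟩
    pos p ℕ.+ pos t          ≡⟨ cong (pos p ℕ.+_) (single-position short-i t) ⟩
    pos p ℕ.+ 1              ≡⟨ ℕP.+-comm (pos p) 1 ⟩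
    suc (pos p)              ∎
    where open ≡-Reasoning

  short-leg-separates-spine : {i k : Fin 3} → Short len i → i ≢ k → (t : Fin (len i)) →
    {u w : V} → OnSpine k u → OnSpine k w → u ≢ w → Separates (leg i t) u w
  short-leg-separates-spine short-i i≢k t su sw u≢w e =
    u≢w (spine-height-injective su sw (ℕP.suc-injective
      (trans (sym (dist-from-short-leg short-i i≢k t su)) (trans e (dist-from-short-leg short-i i≢k t sw)))))

  FirstVerticesOfShortLegs : List V → Set
  FirstVerticesOfShortLegs L = ∃[ i ] ∃[ j ] (i ≢ j × Short len i × Short len j ×
    ((x : V) → x ∈ L → IsFirstOf x i ⊎ IsFirstOf x j) ×
    ((x : V) → IsFirstOf x i ⊎ IsFirstOf x j → x ∈ L))

  off-short-legs-on-spine : {i j k : Fin 3} → Short len i → Short len j →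
    ((m : Fin 3) → m ≢ i → m ≢ j → m ≡ k) →
    (x : V) → ¬ (IsFirstOf x i ⊎ IsFirstOf x j) → OnSpine k x
  off-short-legs-on-spine _ _ _ center _ = at-center
  off-short-legs-on-spine {i} {j} short-i short-j only-k (leg m p) not-first with m ≟F i | m ≟F j
  ... | yes refl | _ = ⊥-elim (not-first (inj₁ (refl , single-position short-i p)))
  ... | no _ | yes refl = ⊥-elim (not-first (inj₂ (refl , single-position short-j p)))
  ... | no m≢i | no m≢j with only-k m m≢i m≢j
  ...   | refl = on-spine p

  -- If L contains the vertices of two short legs i ≠ j, then every vertex outside L
  -- lies on the spine of the third leg, where both vertices separate all pairs.
  short-legs-landmark : (L : List V) (i j : Fin 3) → i ≢ j → Short len i → Short len j →
    ((x : V) → IsFirstOf x i ⊎ IsFirstOf x j → x ∈ L) → IsLandmark L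
  short-legs-landmark L i j i≢j short-i short-j firsts∈L u w u≢w u∉L w∉L
    with third-leg i j i≢j
  ... | k , k≢i , k≢j , only-k =
    leg i tᵢ , leg j tⱼ , (λ e → i≢j (leg-index e)) ,
    firsts∈L _ (inj₁ (refl , single-position short-i tᵢ)) ,
    firsts∈L _ (inj₂ (refl , single-position short-j tⱼ)) ,
    short-leg-separates-spine short-i (≢-sym k≢i) tᵢ u-on-spine w-on-spine u≢w ,
    short-leg-separates-spine short-j (≢-sym k≢j) tⱼ u-on-spine w-on-spine u≢w
    where
      tᵢ : Fin (len i)
      tᵢ = single-vertex short-i
      tⱼ : Fin (len j)
      tⱼ = single-vertex short-j
      u-on-spine : OnSpine k u
      u-on-spine = off-short-legs-on-spine short-i short-j only-k u (λ first → u∉L (firsts∈L u first))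
      w-on-spine : OnSpine k w
      w-on-spine = off-short-legs-on-spine short-i short-j only-k w (λ first → w∉L (firsts∈L w first))

  module LocalSet (len≥1 : (i : Fin 3) → len i ≥ 1) (S : V → Set) (local : IsLocalSet S) where

    at-most-one-empty : (i j : Fin 3) → i ≢ j → Type0 S i → Type0 S j → ⊥
    at-most-one-empty = proj₁ (proj₂ local)

    leg-type : (i : Fin 3) → Type0 S i ⊎ Type1 S i ⊎ Type2 S i ⊎ Type3 S i
    leg-type = proj₁ (proj₂ (proj₂ local))

    beside-empty-long : (i : Fin 3) → Long len i → Type0 S i →
      (j : Fin 3) → j ≢ i → Long len j → Type2 S j
    beside-empty-long = proj₁ (proj₂ (proj₂ (proj₂ local)))

    beside-empty-short : (i : Fin 3) → Short len i → Type0 S i →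
      (j : Fin 3) → Long len j → Type2 S j ⊎ Type3 S j
    beside-empty-short = proj₂ (proj₂ (proj₂ (proj₂ local)))

    Occupied : Fin 3 → Set
    Occupied i = ∃[ r ] S (leg i r)

    empty-or-occupied : (i : Fin 3) → Type0 S i ⊎ Occupied i
    empty-or-occupied i with leg-type i
    ... | inj₁ empty = inj₁ empty
    ... | inj₂ (inj₁ (r , _ , s , _)) = inj₂ (r , s)
    ... | inj₂ (inj₂ (inj₁ (r , _ , _ , s , _))) = inj₂ (r , s)
    ... | inj₂ (inj₂ (inj₂ (r , _ , s , _))) = inj₂ (r , s)

    occupied-beside-empty : {i k : Fin 3} → i ≢ k → Type0 S k → Occupied i
    occupied-beside-empty {i} {k} i≢k empty-k with empty-or-occupied i
    ... | inj₁ empty-i = ⊥-elim (at-most-one-empty i k i≢k empty-i empty-k)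
    ... | inj₂ occupied = occupied

    type2-pair : {j : Fin 3} → Type2 S j → DistinctPair S (OnLeg j)
    type2-pair {j} (p , q , p≢q , sp , sq) =
      leg j p , leg j q , (λ e → p≢q (leg-injective e)) , sp , sq , on-leg p , on-leg q

    -- Beside an empty leg j, a leg k having a vertex outside S at the position of a
    -- vertex of j is of type 2: the rules leave no room for a single S-vertex there.
    type2-beside-empty : {j k : Fin 3} → j ≢ k → Type0 S j →
      (p : Fin (len j)) (q : Fin (len k)) → pos p ≡ pos q → ¬ S (leg k q) → Type2 S k
    type2-beside-empty {j} {k} j≢k empty-j p q same q∉S with empty-or-occupied k
    ... | inj₁ empty-k = ⊥-elim (at-most-one-empty j k j≢k empty-j empty-k)
    ... | inj₂ (r , r∈S) with short-or-long (len≥1 k) | short-or-long (len≥1 j)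
    ...   | inj₁ short-k | _ =
            ⊥-elim (q∉S (subst (λ z → S (leg k z)) (single-vertex-unique short-k r q) r∈S))
    ...   | inj₂ long-k | inj₂ long-j = beside-empty-long j long-j empty-j k (≢-sym j≢k) long-k
    ...   | inj₂ long-k | inj₁ short-j with beside-empty-short j short-j empty-j k long-k
    ...     | inj₁ type2 = type2
    ...     | inj₂ (r′ , first-r′ , r′∈S , _) =
            ⊥-elim (q∉S (subst (λ z → S (leg k z)) r′≡q r′∈S))
      where
        r′≡q : r′ ≡ q
        r′≡q = pos-injective (trans first-r′ (trans (sym (single-position short-j p)) same))

    twin-separators : {j k : Fin 3} → j ≢ k → (p : Fin (len j)) (q : Fin (len k)) → pos p ≡ pos q →
      ¬ S (leg j p) → ¬ S (leg k q) → DistinctPair S (λ τ → OnLeg j τ ⊎ OnLeg k τ)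
    twin-separators {j} {k} j≢k p q same p∉S q∉S with empty-or-occupied j | empty-or-occupied k
    ... | inj₁ empty-j | _ =
          DistinctPair-map (λ s → s) inj₂ (type2-pair (type2-beside-empty j≢k empty-j p q same q∉S))
    ... | inj₂ _ | inj₁ empty-k =
          DistinctPair-map (λ s → s) inj₁
            (type2-pair (type2-beside-empty (≢-sym j≢k) empty-k q p (sym same) p∉S))
    ... | inj₂ (a , a∈S) | inj₂ (b , b∈S) =
          leg j a , leg k b , (λ e → j≢k (leg-index e)) , a∈S , b∈S , inj₁ (on-leg a) , inj₂ (on-leg b)

    module Containing (L : List V) (S⊆L : (x : V) → S x → x ∈ L) where

      twins-separated-in-L : {u w : V} → Twins u w → u ∉ L → w ∉ L →
        DistinctPair (_∈ L) (λ τ → Separates τ u w)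
      twins-separated-in-L (twins p q j≢k same) u∉L w∉L =
        DistinctPair-map (S⊆L _) (twins-separated j≢k same)
          (twin-separators j≢k p q same (λ s → u∉L (S⊆L _ s)) (λ s → w∉L (S⊆L _ s)))

      -- With three distinct vertices, L is a landmark set: either two of them
      -- separate u, w, or two do not and u, w are twins.
      large-landmark : Unique L → 3 ≤ length L → IsLandmark L
      large-landmark unique 3≤|L| u w u≢w u∉L w∉L with three-members unique 3≤|L|
      ... | a , b , c , a≢b , a≢c , b≢c , a∈L , b∈L , c∈L
        with two-of-three (λ τ → dist u τ ℕ.≟ dist w τ) a≢b a≢c b≢c a∈L b∈L c∈L
      ...   | inj₂ separators = separators
      ...   | inj₁ (τ , τ′ , τ≢τ′ , _ , _ , e , e′) =
              twins-separated-in-L (equidistant-twins u w τ τ′ u≢w τ≢τ′ e e′) u∉L w∉L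

      module Small (|L|≤2 : length L ≤ 2) (landmark : IsLandmark L) where

        -- S meets at most two legs, so one leg is empty.
        some-empty-leg : ∃[ k ] Type0 S k
        some-empty-leg with empty-or-occupied zero | empty-or-occupied (suc zero)
                          | empty-or-occupied (suc (suc zero))
        ... | inj₁ empty | _ | _ = zero , empty
        ... | _ | inj₁ empty | _ = suc zero , empty
        ... | _ | _ | inj₁ empty = suc (suc zero) , empty
        ... | inj₂ (a , a∈S) | inj₂ (b , b∈S) | inj₂ (c , c∈S) =
              ⊥-elim (no-three-members |L|≤2 (λ ()) (λ ()) (λ ())
                        (S⊆L _ a∈S) (S⊆L _ b∈S) (S⊆L _ c∈S))

        not-type2 : {i j : Fin 3} → i ≢ j → {b : Fin (len j)} → S (leg j b) → Type2 S i → ⊥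
        not-type2 i≢j b∈S (p , q , p≢q , p∈S , q∈S) =
          no-three-members |L|≤2 (λ e → p≢q (leg-injective e)) (λ e → i≢j (leg-index e))
            (λ e → i≢j (leg-index e)) (S⊆L _ p∈S) (S⊆L _ q∈S) (S⊆L _ b∈S)

        -- If L is {ℓ_i^1, y} with y off leg i and leg i is long, then v and ℓ_i^2
        -- lie outside L and only y can separate them.
        first-vertex-blind : {i j : Fin 3} → i ≢ j → Long len i →
          {a : Fin (len i)} {b : Fin (len j)} → pos a ≡ 1 → S (leg i a) → S (leg j b) → ⊥
        first-vertex-blind {i} {j} i≢j long-i {a} {b} first-a a∈S b∈S =
          no-distinct-pair members ℓ¹-blind (landmark center ℓ² (λ ()) center∉L ℓ²∉L)
          where
            second : Fin (len i)
            second = fromℕ< long-i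
            ℓ² : V
            ℓ² = leg i second
            second-pos : pos second ≡ 2
            second-pos = cong suc (toℕ-fromℕ< long-i)
            members : ∀ {z} → z ∈ L → z ≡ leg i a ⊎ z ≡ leg j b
            members = pair-members |L|≤2 (λ e → i≢j (leg-index e)) (S⊆L _ a∈S) (S⊆L _ b∈S)
            center∉L : center ∉ L
            center∉L center∈L with members center∈L
            ... | inj₁ ()
            ... | inj₂ ()
            ℓ²∉L : ℓ² ∉ L
            ℓ²∉L ℓ²∈L with members ℓ²∈L
            ... | inj₁ e = 1≢2 (trans (sym first-a) (trans (cong pos (sym (leg-injective e))) second-pos))
              where
                1≢2 : 1 ≢ 2
                1≢2 ()
            ... | inj₂ e = i≢j (leg-index e)
            ℓ¹-blind : ¬ Separates (leg i a) center ℓ²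
            ℓ¹-blind separates = separates (trans first-a (sym (begin
              dist ℓ² (leg i a)        ≡⟨ dist-same-leg i second a ⟩
              ℕ.∣ pos second - pos a ∣ ≡⟨ cong₂ ℕ.∣_-_∣ second-pos first-a ⟩
              1                        ∎)))
              where open ≡-Reasoning

        -- Each occupied leg beside the empty leg k is short: a long one would be of
        -- type 2 or consist of its first vertex only.
        occupied-short : {i j k : Fin 3} → i ≢ j → i ≢ k → Type0 S k →
          {a : Fin (len i)} {b : Fin (len j)} → S (leg i a) → S (leg j b) → Short len i
        occupied-short {i} {j} {k} i≢j i≢k empty-k a∈S b∈S with short-or-long (len≥1 i)
        ... | inj₁ short-i = short-i
        ... | inj₂ long-i with short-or-long (len≥1 k)
        ...   | inj₂ long-k = ⊥-elim (not-type2 i≢j b∈S (beside-empty-long k long-k empty-k i i≢k long-i))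
        ...   | inj₁ short-k with beside-empty-short k short-k empty-k i long-i
        ...     | inj₁ type2 = ⊥-elim (not-type2 i≢j b∈S type2)
        ...     | inj₂ (a′ , first-a′ , a′∈S , _) = ⊥-elim (first-vertex-blind i≢j long-i first-a′ a′∈S b∈S)

        small-landmark-shape : FirstVerticesOfShortLegs L
        small-landmark-shape with some-empty-leg
        ... | k , empty-k with other-legs k
        ... | i , j , i≢j , i≢k , j≢k
          with occupied-beside-empty i≢k empty-k | occupied-beside-empty j≢k empty-k
        ... | a , a∈S | b , b∈S = i , j , i≢j , short-i , short-j , members-first , first-members
          where
            short-i : Short len i
            short-i = occupied-short i≢j i≢k empty-k a∈S b∈S
            short-j : Short len j
            short-j = occupied-short (≢-sym i≢j) j≢k empty-k b∈S a∈S
            members-first : (x : V) → x ∈ L → IsFirstOf x i ⊎ IsFirstOf x j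
            members-first x x∈L
              with pair-members |L|≤2 (λ e → i≢j (leg-index e)) (S⊆L _ a∈S) (S⊆L _ b∈S) x∈L
            ... | inj₁ refl = inj₁ (refl , single-position short-i a)
            ... | inj₂ refl = inj₂ (refl , single-position short-j b)
            first-members : (x : V) → IsFirstOf x i ⊎ IsFirstOf x j → x ∈ L
            first-members center (inj₁ ())
            first-members center (inj₂ ())
            first-members (leg _ r) (inj₁ (refl , _)) =
              S⊆L _ (subst (λ z → S (leg i z)) (single-vertex-unique short-i a r) a∈S)
            first-members (leg _ r) (inj₂ (refl , _)) =
              S⊆L _ (subst (λ z → S (leg j z)) (single-vertex-unique short-j b r) b∈S)

lemma8 : (len : Fin 3 → ℕ) → ((i : Fin 3) → len i ≥ 1) → (∃[ i ] Short len i) →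
    (L : List (Vert len)) → Unique L → ContainsLocalSet L →
    (length L ≥ 3 → IsLandmark L) ×
    (length L ≤ 2 →
      (IsLandmark L →
        ∃[ i ] ∃[ j ] (i ≢ j × Short len i × Short len j ×
          ((x : Vert len) → x ∈ L → IsFirstOf x i ⊎ IsFirstOf x j) ×
          ((x : Vert len) → IsFirstOf x i ⊎ IsFirstOf x j → x ∈ L))) ×
      (∃[ i ] ∃[ j ] (i ≢ j × Short len i × Short len j ×
          ((x : Vert len) → x ∈ L → IsFirstOf x i ⊎ IsFirstOf x j) ×
          ((x : Vert len) → IsFirstOf x i ⊎ IsFirstOf x j → x ∈ L)) →
        IsLandmark L))
lemma8 len len≥1 _ L unique (S , S⊆L , local) =
  large-landmark unique ,
  λ |L|≤2 →
    (λ landmark → Small.small-landmark-shape |L|≤2 landmark) ,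
    (λ { (i , j , i≢j , short-i , short-j , _ , firsts∈L) →
           short-legs-landmark L i j i≢j short-i short-j firsts∈L })
  where
    open LocalSet len≥1 S local
    open Containing L S⊆L
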